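{- Let $A$ be a pseudo $BL$-algebra and $F$ an interval valued $(\in,\in\!\vee q)$-fuzzy implicative filter of $A$. Then for all $x,y\in A$: (1) $\widehat{\mu_F}(x)\ge\mathrm{rmin}\{\widehat{\mu_F}((x\rightarrow y)\rightarrow x),[0.5,0.5]\}$ and $\widehat{\mu_F}(x)\ge\mathrm{rmin}\{\widehat{\mu_F}((x\hookrightarrow y)\hookrightarrow x),[0.5,0.5]\}$; (2) $\widehat{\mu_F}(((y\rightarrow x)\hookrightarrow x)\rightarrow y)\ge\mathrm{rmin}\{\widehat{\mu_F}(x\rightarrow y),[0.5,0.5]\}$ and $\widehat{\mu_F}(((y\hookrightarrow x)\rightarrow x)\hookrightarrow y)\ge\mathrm{rmin}\{\widehat{\mu_F}(x\hookrightarrow y),[0.5,0.5]\}$; (3) $\widehat{\mu_F}((y\hookrightarrow x)\rightarrow x)\ge\mathrm{rmin}\{\widehat{\mu_F}((x\rightarrow y)\hookrightarrow y),[0.5,0.5]\}$ and $\widehat{\mu_F}((y\rightarrow x)\hookrightarrow x)\ge\mathrm{rmin}\{\widehat{\mu_F}((x\hookrightarrow y)\rightarrow y),[0.5,0.5]\}$; (4) $\widehat{\mu_F}((y\rightarrow x)\hookrightarrow x)\ge\mathrm{rmin}\{\widehat{\mu_F}((x\rightarrow y)\hookrightarrow y),[0.5,0.5]\}$ and $\widehat{\mu_F}((y\hookrightarrow x)\rightarrow x)\ge\mathrm{rmin}\{\widehat{\mu_F}((x\hookrightarrow y)\hookrightarrow y),[0.5,0.5]\}$.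
   Context: A pseudo $BL$-algebra is an algebra $(A;\wedge,\vee,\odot,\rightarrow,\hookrightarrow,0,1)$ of type $(2,2,2,2,2,0,0)$ such that $(A,\wedge,\vee,0,1)$ is a bounded lattice with lattice order $\le$, $(A,\odot,1)$ is a monoid, and for all $x,y,z\in A$: (a1) $x\odot y\le z\iff x\le y\rightarrow z\iff y\le x\hookrightarrow z$; (a2) $x\wedge y=(x\rightarrow y)\odot x=x\odot(x\hookrightarrow y)$; (a3) $(x\rightarrow y)\vee(y\rightarrow x)=(x\hookrightarrow y)\vee(y\hookrightarrow x)=1$. An interval number is $\widehat{a}=[a^{\bot},a^{\top}]$ with $0\le a^{\bot}\le a^{\top}\le 1$; $D[0,1]$ is the set of interval numbers. $\widehat{a}\le\widehat{b}$ iff $a^{\bot}\le b^{\bot}$ and $a^{\top}\le b^{\top}$; $\widehat{a}<\widehat{b}$ iff $\widehat{a}\le\widehat{b}$ and $\widehat{a}\ne\widehat{b}$; $\mathrm{rmin},\mathrm{rmax}$ and sums are componentwise. An interval valued fuzzy set $F$ of $A$ is a map $\widehat{\mu_F}:A\to D[0,1]$; standing assumption: for every $x\in A$, either $\widehat{\mu_F}(x)<[0.5,0.5]$ or $[0.5,0.5]\le\widehat{\mu_F}(x)$. For $x\in A$ and nonzero $\widehat t\in D[0,1]$: $U(x;\widehat t)\in F$ means $\widehat{\mu_F}(x)\ge\widehat t$; $U(x;\widehat t)\,q\,F$ means $\widehat{\mu_F}(x)+\widehat t>[1,1]$; $U(x;\widehat t)\in\!\vee q\,F$ means one of these holds. $F$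 is an interval valued $(\in,\in\!\vee q)$-fuzzy filter if for all nonzero $\widehat t,\widehat r\in D[0,1]$ and $x,y\in A$: (F3) $U(x;\widehat t)\in F$ and $U(y;\widehat r)\in F$ imply $U(x\odot y;\mathrm{rmin}\{\widehat t,\widehat r\})\in\!\vee q\,F$; (F4) if $x\le y$ and $U(x;\widehat r)\in F$ then $U(y;\widehat r)\in\!\vee q\,F$. It is an interval valued $(\in,\in\!\vee q)$-fuzzy implicative filter if moreover, for all $x,y\in A$, (F13) $\widehat{\mu_F}(x)\ge\mathrm{rmin}\{\widehat{\mu_F}((x\rightarrow y)\hookrightarrow x),[0.5,0.5]\}$ and $\widehat{\mu_F}(x)\ge\mathrm{rmin}\{\widehat{\mu_F}((x\hookrightarrow y)\rightarrow x),[0.5,0.5]\}$. -}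

module Defs where

open import Level using (0ℓ)
open import Data.Product using (Σ; ∃; _×_; _,_)
open import Data.Sum using (_⊎_; inj₁; inj₂)
open import Relation.Nullary using (¬_; Dec; yes; no)
open import Relation.Binary.PropositionalEquality using (_≡_; refl)
open import Algebra.Structures using (IsCommutativeRing; IsMonoid)
open import Algebra.Lattice.Structures using (IsLattice)

-- The real numbers, axiomatised as a complete ordered field
-- (any two such structures are isomorphic, so this is ℝ).

record RealNumbers : Set₁ where
  infixl 6 _+_
  infixl 7 _*_
  infix 4 _≤_
  field
    ℝ     : Set
    _+_   : ℝ → ℝ → ℝ
    _*_   : ℝ → ℝ → ℝ
    -_    : ℝ → ℝ
    0ℝ    : ℝ
    1ℝ    : ℝ
    isCommutativeRing : IsCommutativeRing _≡_ _+_ _*_ -_ 0ℝ 1ℝ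
    0≢1   : ¬ (0ℝ ≡ 1ℝ)
    inverse : ∀ x → ¬ (x ≡ 0ℝ) → ∃ λ y → x * y ≡ 1ℝ
    _≤_   : ℝ → ℝ → Set
    ≤-refl    : ∀ {x} → x ≤ x
    ≤-trans   : ∀ {x y z} → x ≤ y → y ≤ z → x ≤ z
    ≤-antisym : ∀ {x y} → x ≤ y → y ≤ x → x ≡ y
    ≤-total   : ∀ x y → (x ≤ y) ⊎ (y ≤ x)
    _≤?_      : ∀ x y → Dec (x ≤ y)
    +-mono-≤  : ∀ {x y} z → x ≤ y → x + z ≤ y + z
    *-nonneg  : ∀ {x y} → 0ℝ ≤ x → 0ℝ ≤ y → 0ℝ ≤ x * y
    complete  : (P : ℝ → Set) → ∃ P → (∃ λ b → ∀ x → P x → x ≤ b) →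
                ∃ λ s → (∀ x → P x → x ≤ s) ×
                        (∀ b → (∀ x → P x → x ≤ b) → s ≤ b)
    half      : ℝ
    half+half : half + half ≡ 1ℝ

module Intervals (Rl : RealNumbers) where
  open RealNumbers Rl

  min : ℝ → ℝ → ℝ
  min x y with x ≤? y
  ... | yes _ = x
  ... | no  _ = y

  private
    ≰⇒≥ : ∀ {x y} → ¬ (x ≤ y) → y ≤ x
    ≰⇒≥ {x} {y} n with ≤-total x y
    ... | inj₁ p = Data.Empty.⊥-elim (n p)
      where import Data.Empty
    ... | inj₂ p = p

    min-glb : ∀ {z x y} → z ≤ x → z ≤ y → z ≤ min x y
    min-glb {z} {x} {y} p q with x ≤? y
    ... | yes _ = p
    ... | no  _ = q

    min-≤ˡ : ∀ x y → min x y ≤ x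
    min-≤ˡ x y with x ≤? y
    ... | yes _ = ≤-refl
    ... | no  n = ≰⇒≥ n

    min-≤ʳ : ∀ x y → min x y ≤ y
    min-≤ʳ x y with x ≤? y
    ... | yes p = p
    ... | no  _ = ≤-refl

  record D : Set where
    constructor ⟦_,_⟧⟨_,_,_⟩
    field
      lo     : ℝ
      hi     : ℝ
      0≤lo   : 0ℝ ≤ lo
      lo≤hi  : lo ≤ hi
      hi≤1   : hi ≤ 1ℝ
  open D public

  infix 4 _≤ᵢ_ _<ᵢ_ _≈ᵢ_

  _≈ᵢ_ : D → D → Set
  a ≈ᵢ b = (lo a ≡ lo b) × (hi a ≡ hi b)

  _≤ᵢ_ : D → D → Set
  a ≤ᵢ b = (lo a ≤ lo b) × (hi a ≤ hi b)

  _<ᵢ_ : D → D → Set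
  a <ᵢ b = (a ≤ᵢ b) × ¬ (a ≈ᵢ b)

  rmin : D → D → D
  rmin a b = record
    { lo    = min (lo a) (lo b)
    ; hi    = min (hi a) (hi b)
    ; 0≤lo  = min-glb (0≤lo a) (0≤lo b)
    ; lo≤hi = min-glb (≤-trans (min-≤ˡ (lo a) (lo b)) (lo≤hi a))
                      (≤-trans (min-≤ʳ (lo a) (lo b)) (lo≤hi b))
    ; hi≤1  = ≤-trans (min-≤ˡ (hi a) (hi b)) (hi≤1 a)
    }

  ½̂ : D
  ½̂ = record { lo = half ; hi = half ; 0≤lo = 0≤half ; lo≤hi = ≤-refl
             ; hi≤1 = half≤1 }
    where
    0≤half : 0ℝ ≤ half
    0≤half with 0ℝ ≤? half
    ... | yes p = p
    ... | no n = Data.Empty.⊥-elim (n (contra (≰⇒≥ n)))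
      where
      import Data.Empty
      open import Relation.Binary.PropositionalEquality using (subst; sym)
      open IsCommutativeRing isCommutativeRing using (+-identityˡ)
      -- half ≤ 0 gives 1 = half + half ≤ half ≤ 0, impossible with 0 ≤ 1
      contra : half ≤ 0ℝ → 0ℝ ≤ half
      contra h = Data.Empty.⊥-elim (0≢1 (≤-antisym 0≤1' 1≤0))
        where
        1≤0 : 1ℝ ≤ 0ℝ
        1≤0 = subst (_≤ 0ℝ) half+half
                (≤-trans (+-mono-≤ half h)
                  (subst (_≤ 0ℝ) (sym (+-identityˡ half)) h))
        0≤1' : 0ℝ ≤ 1ℝ
        0≤1' with 0ℝ ≤? 1ℝ
        ... | yes p = p
        ... | no m = Data.Empty.⊥-elim (m (lemma (≰⇒≥ m)))
          where
          open IsCommutativeRing isCommutativeRing using (-‿inverseʳ; +-identityʳ)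
          open import Algebra.Properties.Ring using ()
          lemma : 1ℝ ≤ 0ℝ → 0ℝ ≤ 1ℝ
          lemma q = subst (λ t → 0ℝ ≤ t) (*-one) (*-nonneg n1 n1)
            where
            n1 : 0ℝ ≤ (- 1ℝ)
            n1 = subst₂ _≤_ (-‿inverseʳ 1ℝ) (+-identityˡ (- 1ℝ))
                   (+-mono-≤ (- 1ℝ) q)
              where open import Relation.Binary.PropositionalEquality using (subst₂)
            *-one : (- 1ℝ) * (- 1ℝ) ≡ 1ℝ
            *-one = ring-lemma
              where
              open import Algebra.Bundles using (CommutativeRing)
              CR : CommutativeRing 0ℓ 0ℓ
              CR = record { isCommutativeRing = isCommutativeRing }
              open import Algebra.Properties.Ring (CommutativeRing.ring CR)
                using (-1*x≈-x; -‿involutive)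
              ring-lemma : (- 1ℝ) * (- 1ℝ) ≡ 1ℝ
              ring-lemma = Relation.Binary.PropositionalEquality.trans
                             (-1*x≈-x (- 1ℝ)) (-‿involutive 1ℝ)
                where import Relation.Binary.PropositionalEquality
    half≤1 : half ≤ 1ℝ
    half≤1 = subst (_≤ 1ℝ) (+-identityˡ half)
               (subst (λ t → 0ℝ + half ≤ t) half+half (+-mono-≤ half 0≤half))
      where
      open import Relation.Binary.PropositionalEquality using (subst)
      open IsCommutativeRing isCommutativeRing using (+-identityˡ)

  nonzero : D → Set
  nonzero t = ¬ ((lo t ≡ 0ℝ) × (hi t ≡ 0ℝ))

  -- U(x; t) ∈ F  for the value m = μ(x)
  _∈ᵛ_ : D → D → Set
  t ∈ᵛ m = t ≤ᵢ m

  -- U(x; t) q F :  μ(x) + t > [1,1]   (componentwise sums)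
  _qᵛ_ : D → D → Set
  t qᵛ m = ((1ℝ ≤ lo m + lo t) × (1ℝ ≤ hi m + hi t))
           × ¬ ((lo m + lo t ≡ 1ℝ) × (hi m + hi t ≡ 1ℝ))

  _∈∨qᵛ_ : D → D → Set
  t ∈∨qᵛ m = (t ∈ᵛ m) ⊎ (t qᵛ m)

record PseudoBL : Set₁ where
  infixr 6 _∧_
  infixr 5 _∨_
  infixl 7 _⊙_
  infixr 4 _⇒_ _↪_
  infix 3 _≼_
  field
    A   : Set
    _∧_ _∨_ _⊙_ _⇒_ _↪_ : A → A → A
    𝟘 𝟙 : A
    isLattice : IsLattice _≡_ _∨_ _∧_
  _≼_ : A → A → Set
  x ≼ y = x ∧ y ≡ x
  field
    𝟘-least    : ∀ x → 𝟘 ≼ x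
    𝟙-greatest : ∀ x → x ≼ 𝟙
    isMonoid   : IsMonoid _≡_ _⊙_ 𝟙
    a1-⇒ : ∀ x y z → (x ⊙ y ≼ z → x ≼ y ⇒ z) × (x ≼ y ⇒ z → x ⊙ y ≼ z)
    a1-↪ : ∀ x y z → (x ⊙ y ≼ z → y ≼ x ↪ z) × (y ≼ x ↪ z → x ⊙ y ≼ z)
    a2-⇒ : ∀ x y → x ∧ y ≡ (x ⇒ y) ⊙ x
    a2-↪ : ∀ x y → x ∧ y ≡ x ⊙ (x ↪ y)
    a3-⇒ : ∀ x y → (x ⇒ y) ∨ (y ⇒ x) ≡ 𝟙
    a3-↪ : ∀ x y → (x ↪ y) ∨ (y ↪ x) ≡ 𝟙

module FuzzyFilters (Rl : RealNumbers) (𝔄 : PseudoBL) where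
  open RealNumbers Rl
  open Intervals Rl
  open PseudoBL 𝔄

  -- standing assumption on interval valued fuzzy sets
  Dichotomous : (A → D) → Set
  Dichotomous μ = ∀ x → (μ x <ᵢ ½̂) ⊎ (½̂ ≤ᵢ μ x)

  record IsFuzzyFilter (μ : A → D) : Set where
    field
      F3 : ∀ (t r : D) → nonzero t → nonzero r → ∀ x y →
           t ∈ᵛ μ x → r ∈ᵛ μ y → rmin t r ∈∨qᵛ μ (x ⊙ y)
      F4 : ∀ (r : D) → nonzero r → ∀ x y →
           x ≼ y → r ∈ᵛ μ x → r ∈∨qᵛ μ y

  record IsFuzzyImplicativeFilter (μ : A → D) : Set where
    field
      isFuzzyFilter : IsFuzzyFilter μ
      F13-⇒ : ∀ x y → rmin (μ ((x ⇒ y) ↪ x)) ½̂ ≤ᵢ μ x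
      F13-↪ : ∀ x y → rmin (μ ((x ↪ y) ⇒ x)) ½̂ ≤ᵢ μ x

-- The level sets {a | t ≤ μ a} with t ≤ [0.5,0.5] of an interval valued (∈,∈∨q)-fuzzy
-- implicative filter are implicative filters in the crisp sense: below [0.5,0.5] the
-- "q" alternative can never hold, so (F3), (F4) and (F13) become closure properties.
-- A crisp implicative filter contains x ∨ ¬x for both negations x ⇒ 𝟘 and x ↪ 𝟘, and
-- since ⊙ distributes over ∨, each of the eight implications follows by splitting on
-- x ∨ ¬x (or y ∨ ¬y). Taking t = rmin (μ a) [0.5,0.5] turns them into the inequalities.

module Submission where

open import Defs
open import Data.Product using (_×_; _,_)
open import Data.Sum using (_⊎_; inj₁; inj₂)
open import Data.Empty using (⊥-elim)
open import Relation.Nullary using (¬_; Dec; yes; no)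
open import Relation.Nullary.Decidable using (_×-dec_)
open import Relation.Binary.PropositionalEquality
  using (_≡_; refl; sym; trans; subst; subst₂; isEquivalence)
open import Relation.Binary.Bundles using (Preorder)
open import Algebra.Structures using (IsMonoid; IsCommutativeRing)
import Algebra.Lattice.Properties.Lattice as LatticeProperties
import Relation.Binary.Lattice.Bundles as OrderTheoretic
import Relation.Binary.Reasoning.Preorder as PreorderReasoning

module PseudoBLProperties (𝔄 : PseudoBL) where
  open PseudoBL 𝔄
  open IsMonoid isMonoid using (identityˡ; identityʳ) renaming (assoc to ⊙-assoc)

  private
    orderLattice : OrderTheoretic.Lattice _ _ _
    orderLattice = LatticeProperties.∨-∧-orderTheoreticLattice
                     (record { isLattice = isLattice })
    module O = OrderTheoretic.Lattice orderLattice

  -- The library orders a lattice by x ≡ x ∧ y, the symmetric form of _≼_.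

  ≼-refl : ∀ {x} → x ≼ x
  ≼-refl = sym O.refl

  ≼-trans : ∀ {x y z} → x ≼ y → y ≼ z → x ≼ z
  ≼-trans p q = sym (O.trans (sym p) (sym q))

  x≼x∨y : ∀ {x y} → x ≼ x ∨ y
  x≼x∨y {x} {y} = sym (O.x≤x∨y x y)

  y≼x∨y : ∀ {x y} → y ≼ x ∨ y
  y≼x∨y {x} {y} = sym (O.y≤x∨y x y)

  ∨-least : ∀ {x y z} → x ≼ z → y ≼ z → x ∨ y ≼ z
  ∨-least p q = sym (O.∨-least (sym p) (sym q))

  curry-⇒ : ∀ {x y z} → x ⊙ y ≼ z → x ≼ y ⇒ z
  curry-⇒ {x} {y} {z} with a1-⇒ x y z
  ... | (to , _) = to

  uncurry-⇒ : ∀ {x y z} → x ≼ y ⇒ z → x ⊙ y ≼ z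
  uncurry-⇒ {x} {y} {z} with a1-⇒ x y z
  ... | (_ , from) = from

  curry-↪ : ∀ {x y z} → x ⊙ y ≼ z → y ≼ x ↪ z
  curry-↪ {x} {y} {z} with a1-↪ x y z
  ... | (to , _) = to

  uncurry-↪ : ∀ {x y z} → y ≼ x ↪ z → x ⊙ y ≼ z
  uncurry-↪ {x} {y} {z} with a1-↪ x y z
  ... | (_ , from) = from

  modus-ponens-⇒ : ∀ {x y} → (x ⇒ y) ⊙ x ≼ y
  modus-ponens-⇒ = uncurry-⇒ ≼-refl

  modus-ponens-↪ : ∀ {x y} → x ⊙ (x ↪ y) ≼ y
  modus-ponens-↪ = uncurry-↪ ≼-refl

  ⊙-monoˡ-≼ : ∀ {x y z} → x ≼ y → x ⊙ z ≼ y ⊙ z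
  ⊙-monoˡ-≼ x≼y = uncurry-⇒ (≼-trans x≼y (curry-⇒ ≼-refl))

  ⊙-monoʳ-≼ : ∀ {x y z} → x ≼ y → z ⊙ x ≼ z ⊙ y
  ⊙-monoʳ-≼ x≼y = uncurry-↪ (≼-trans x≼y (curry-↪ ≼-refl))

  x⊙y≼x : ∀ {x y} → x ⊙ y ≼ x
  x⊙y≼x {x} {y} = subst (x ⊙ y ≼_) (identityʳ x) (⊙-monoʳ-≼ (𝟙-greatest y))

  x⊙y≼y : ∀ {x y} → x ⊙ y ≼ y
  x⊙y≼y {x} {y} = subst (x ⊙ y ≼_) (identityˡ y) (⊙-monoˡ-≼ (𝟙-greatest x))

  ⊙-∨-leastˡ : ∀ {x y z w} → x ⊙ y ≼ w → x ⊙ z ≼ w → x ⊙ (y ∨ z) ≼ w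
  ⊙-∨-leastˡ p q = uncurry-↪ (∨-least (curry-↪ p) (curry-↪ q))

  ⊙-∨-leastʳ : ∀ {x y z w} → y ⊙ x ≼ w → z ⊙ x ≼ w → (y ∨ z) ⊙ x ≼ w
  ⊙-∨-leastʳ p q = uncurry-⇒ (∨-least (curry-⇒ p) (curry-⇒ q))

  ⇒𝟘≼⇒ : ∀ {x y} → x ⇒ 𝟘 ≼ x ⇒ y
  ⇒𝟘≼⇒ {y = y} = curry-⇒ (≼-trans modus-ponens-⇒ (𝟘-least y))

  ↪𝟘≼↪ : ∀ {x y} → x ↪ 𝟘 ≼ x ↪ y
  ↪𝟘≼↪ {y = y} = curry-↪ (≼-trans modus-ponens-↪ (𝟘-least y))

  ⇒𝟘-antitone : ∀ {x y} → x ≼ y → y ⇒ 𝟘 ≼ x ⇒ 𝟘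
  ⇒𝟘-antitone x≼y = curry-⇒ (≼-trans (⊙-monoʳ-≼ x≼y) modus-ponens-⇒)

  ↪𝟘-antitone : ∀ {x y} → x ≼ y → y ↪ 𝟘 ≼ x ↪ 𝟘
  ↪𝟘-antitone x≼y = curry-↪ (≼-trans (⊙-monoˡ-≼ x≼y) modus-ponens-↪)

  record IsImplicativeFilter (P : A → Set) : Set where
    field
      ≼-closed      : ∀ {a b} → P a → a ≼ b → P b
      ⊙-closed      : ∀ {a b} → P a → P b → P (a ⊙ b)
      implicative-⇒ : ∀ x y → P ((x ⇒ y) ↪ x) → P x
      implicative-↪ : ∀ x y → P ((x ↪ y) ⇒ x) → P x

  module ImplicativeFilterProperties {P : A → Set} (F : IsImplicativeFilter P) where
    open IsImplicativeFilter F

    -- For z = x ∨ (x ⇒ 𝟘) already (z ⇒ 𝟘) ↪ z is 𝟙, so implicativity with y = 𝟘 applies.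
    excluded-middle-⇒ : ∀ {a} → P a → ∀ x → P (x ∨ (x ⇒ 𝟘))
    excluded-middle-⇒ pa x = implicative-⇒ (x ∨ (x ⇒ 𝟘)) 𝟘
      (≼-closed pa (≼-trans (𝟙-greatest _)
        (curry-↪ (subst (_≼ _) (sym (identityʳ _))
          (≼-trans (⇒𝟘-antitone x≼x∨y) y≼x∨y)))))

    excluded-middle-↪ : ∀ {a} → P a → ∀ x → P (x ∨ (x ↪ 𝟘))
    excluded-middle-↪ pa x = implicative-↪ (x ∨ (x ↪ 𝟘)) 𝟘
      (≼-closed pa (≼-trans (𝟙-greatest _)
        (curry-⇒ (subst (_≼ _) (sym (identityˡ _))
          (≼-trans (↪𝟘-antitone x≼x∨y) y≼x∨y)))))

    ∨-casesˡ : ∀ {a b c z} → P a → P (b ∨ c) → a ⊙ b ≼ z → a ⊙ c ≼ z → P z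
    ∨-casesˡ pa pb∨c p q = ≼-closed (⊙-closed pa pb∨c) (⊙-∨-leastˡ p q)

    ∨-casesʳ : ∀ {a b c z} → P a → P (b ∨ c) → b ⊙ a ≼ z → c ⊙ a ≼ z → P z
    ∨-casesʳ pa pb∨c p q = ≼-closed (⊙-closed pb∨c pa) (⊙-∨-leastʳ p q)

    peirce-⇒ : ∀ x y → P ((x ⇒ y) ⇒ x) → P x
    peirce-⇒ x y pa = ∨-casesˡ pa (excluded-middle-⇒ pa x)
      x⊙y≼y
      (≼-trans (⊙-monoʳ-≼ ⇒𝟘≼⇒) modus-ponens-⇒)

    peirce-↪ : ∀ x y → P ((x ↪ y) ↪ x) → P x
    peirce-↪ x y pa = ∨-casesʳ pa (excluded-middle-↪ pa x)
      x⊙y≼x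
      (≼-trans (⊙-monoˡ-≼ ↪𝟘≼↪) modus-ponens-↪)

    ⇒-⇒↪⇒ : ∀ x y → P (x ⇒ y) → P (((y ⇒ x) ↪ x) ⇒ y)
    ⇒-⇒↪⇒ x y pa = ∨-casesˡ pa (excluded-middle-⇒ pa y)
      (curry-⇒ (≼-trans x⊙y≼x x⊙y≼y))
      (curry-⇒ (subst (_≼ y) (sym (⊙-assoc (x ⇒ y) (y ⇒ 𝟘) ((y ⇒ x) ↪ x)))
        (≼-trans (⊙-monoʳ-≼ (≼-trans (⊙-monoˡ-≼ ⇒𝟘≼⇒) modus-ponens-↪))
          modus-ponens-⇒)))

    ↪-↪⇒↪ : ∀ x y → P (x ↪ y) → P (((y ↪ x) ⇒ x) ↪ y)
    ↪-↪⇒↪ x y pa = ∨-casesʳ pa (excluded-middle-↪ pa y)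
      (curry-↪ (≼-trans x⊙y≼y x⊙y≼x))
      (curry-↪ (subst (_≼ y) (⊙-assoc ((y ↪ x) ⇒ x) (y ↪ 𝟘) (x ↪ y))
        (≼-trans (⊙-monoˡ-≼ (≼-trans (⊙-monoʳ-≼ ↪𝟘≼↪) modus-ponens-⇒))
          modus-ponens-↪)))

    ⇒↪-↪⇒ : ∀ x y → P ((x ⇒ y) ↪ y) → P ((y ↪ x) ⇒ x)
    ⇒↪-↪⇒ x y pa = ∨-casesʳ pa (excluded-middle-⇒ pa x)
      (curry-⇒ (≼-trans x⊙y≼x x⊙y≼x))
      (curry-⇒ (≼-trans (⊙-monoˡ-≼ (≼-trans (⊙-monoˡ-≼ ⇒𝟘≼⇒) modus-ponens-↪))
        modus-ponens-↪))

    ↪⇒-⇒↪ : ∀ x y → P ((x ↪ y) ⇒ y) → P ((y ⇒ x) ↪ x)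
    ↪⇒-⇒↪ x y pa = ∨-casesˡ pa (excluded-middle-↪ pa x)
      (curry-↪ (≼-trans x⊙y≼y x⊙y≼y))
      (curry-↪ (≼-trans (⊙-monoʳ-≼ (≼-trans (⊙-monoʳ-≼ ↪𝟘≼↪) modus-ponens-⇒))
        modus-ponens-⇒))

    ⇒↪-⇒↪ : ∀ x y → P ((x ⇒ y) ↪ y) → P ((y ⇒ x) ↪ x)
    ⇒↪-⇒↪ x y pa = ∨-casesʳ pa (excluded-middle-⇒ pa x)
      (curry-↪ (≼-trans x⊙y≼y x⊙y≼x))
      (curry-↪ (≼-trans (⊙-monoʳ-≼ (≼-trans (⊙-monoˡ-≼ ⇒𝟘≼⇒) modus-ponens-↪))
        modus-ponens-⇒))

    ↪↪-↪⇒ : ∀ x y → P ((x ↪ y) ↪ y) → P ((y ↪ x) ⇒ x)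
    ↪↪-↪⇒ x y pa = ∨-casesʳ pa (excluded-middle-↪ pa x)
      (curry-⇒ (≼-trans x⊙y≼x x⊙y≼x))
      (curry-⇒ (≼-trans (⊙-monoˡ-≼ (≼-trans (⊙-monoˡ-≼ ↪𝟘≼↪) modus-ponens-↪))
        modus-ponens-↪))

module IntervalProperties (Rl : RealNumbers) where
  open RealNumbers Rl
  open Intervals Rl
  open IsCommutativeRing isCommutativeRing using (+-comm)

  ≰⇒≥ : ∀ {x y} → ¬ (x ≤ y) → y ≤ x
  ≰⇒≥ {x} {y} x≰y with ≤-total x y
  ... | inj₁ x≤y = ⊥-elim (x≰y x≤y)
  ... | inj₂ y≤x = y≤x

  min-greatest : ∀ {z x y} → z ≤ x → z ≤ y → z ≤ min x y
  min-greatest {x = x} {y} p q with x ≤? y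
  ... | yes _ = p
  ... | no  _ = q

  min-≤ˡ : ∀ x y → min x y ≤ x
  min-≤ˡ x y with x ≤? y
  ... | yes _   = ≤-refl
  ... | no  x≰y = ≰⇒≥ x≰y

  min-≤ʳ : ∀ x y → min x y ≤ y
  min-≤ʳ x y with x ≤? y
  ... | yes x≤y = x≤y
  ... | no  _   = ≤-refl

  min-idem : ∀ x → min x x ≡ x
  min-idem x with x ≤? x
  ... | yes _ = refl
  ... | no  _ = refl

  +-mono-≤₂ : ∀ {p q r s} → p ≤ q → r ≤ s → p + r ≤ q + s
  +-mono-≤₂ {q = q} {r} {s} p≤q r≤s =
    ≤-trans (+-mono-≤ r p≤q) (subst₂ _≤_ (+-comm r q) (+-comm s q) (+-mono-≤ q r≤s))

  ≤ᵢ-refl : ∀ a → a ≤ᵢ a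
  ≤ᵢ-refl _ = ≤-refl , ≤-refl

  ≤ᵢ-preorder : Preorder _ _ _
  ≤ᵢ-preorder = record
    { Carrier    = D
    ; _≈_        = _≡_
    ; _≲_        = _≤ᵢ_
    ; isPreorder = record
      { isEquivalence = isEquivalence
      ; reflexive     = λ { {a} refl → ≤ᵢ-refl a }
      ; trans         = λ (p , q) (r , s) → ≤-trans p r , ≤-trans q s
      }
    }

  _≤ᵢ?_ : ∀ a b → Dec (a ≤ᵢ b)
  a ≤ᵢ? b = (lo a ≤? lo b) ×-dec (hi a ≤? hi b)

  rmin-greatest : ∀ t a b → t ≤ᵢ a → t ≤ᵢ b → t ≤ᵢ rmin a b
  rmin-greatest _ _ _ (p , q) (r , s) = min-greatest p r , min-greatest q s

  rmin-≤ˡ : ∀ a b → rmin a b ≤ᵢ a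
  rmin-≤ˡ a b = min-≤ˡ (lo a) (lo b) , min-≤ˡ (hi a) (hi b)

  rmin-≤ʳ : ∀ a b → rmin a b ≤ᵢ b
  rmin-≤ʳ a b = min-≤ʳ (lo a) (lo b) , min-≤ʳ (hi a) (hi b)

  nonzero-rmin-self : ∀ t → nonzero (rmin t t) → nonzero t
  nonzero-rmin-self t nz (lo≡0 , hi≡0) =
    nz (trans (min-idem (lo t)) lo≡0 , trans (min-idem (hi t)) hi≡0)

  nonzero-of-≰ : ∀ t m → ¬ (t ≤ᵢ m) → nonzero t
  nonzero-of-≰ t m t≰m (lo≡0 , hi≡0) = t≰m
    ( subst (_≤ lo m) (sym lo≡0) (0≤lo m)
    , subst (_≤ hi m) (sym hi≡0) (≤-trans (0≤lo m) (lo≤hi m)) )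

  ¬q-below-½ : ∀ t m → t ≤ᵢ ½̂ → m ≤ᵢ ½̂ → ¬ (t qᵛ m)
  ¬q-below-½ t m (t₁ , t₂) (m₁ , m₂) ((1≤lo , 1≤hi) , ≢1) =
    ≢1 (≤-antisym (≤-½+½ m₁ t₁) 1≤lo , ≤-antisym (≤-½+½ m₂ t₂) 1≤hi)
    where
    ≤-½+½ : ∀ {p r} → p ≤ half → r ≤ half → p + r ≤ 1ℝ
    ≤-½+½ p≤½ r≤½ = subst (_ ≤_) half+half (+-mono-≤₂ p≤½ r≤½)

  -- The zero interval, excluded from (F3) and (F4), lies below every m anyway.
  ∈∨q⇒∈-below-½ : ∀ t m → t ≤ᵢ ½̂ → (m <ᵢ ½̂) ⊎ (½̂ ≤ᵢ m) →
                  (nonzero t → t ∈∨qᵛ m) → t ∈ᵛ m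
  ∈∨q⇒∈-below-½ t m t≤½ (inj₂ ½≤m) _ = begin t ≲⟨ t≤½ ⟩ ½̂ ≲⟨ ½≤m ⟩ m ∎
    where open PreorderReasoning ≤ᵢ-preorder
  ∈∨q⇒∈-below-½ t m t≤½ (inj₁ (m≤½ , _)) t∈∨qm with t ≤ᵢ? m
  ... | yes t≤m = t≤m
  ... | no  t≰m with t∈∨qm (nonzero-of-≰ t m t≰m)
  ...   | inj₁ t≤m = t≤m
  ...   | inj₂ tqm = ⊥-elim (¬q-below-½ t m t≤½ m≤½ tqm)

module LevelSets (Rl : RealNumbers) (𝔄 : PseudoBL) where
  open Intervals Rl
  open PseudoBL 𝔄
  open FuzzyFilters Rl 𝔄
  open PseudoBLProperties 𝔄 using (IsImplicativeFilter)
  open IntervalProperties Rl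
  open PreorderReasoning ≤ᵢ-preorder

  module _ {μ : A → D} (dichotomous : Dichotomous μ)
           (isImplicative : IsFuzzyImplicativeFilter μ) where
    open IsFuzzyImplicativeFilter isImplicative
    open IsFuzzyFilter isFuzzyFilter

    level-isImplicativeFilter : ∀ t → t ≤ᵢ ½̂ → IsImplicativeFilter (λ a → t ≤ᵢ μ a)
    level-isImplicativeFilter t t≤½ = record
      { ≼-closed      = λ {a} {b} t≤μa a≼b →
          ∈∨q⇒∈-below-½ t (μ b) t≤½ (dichotomous b)
            (λ nz → F4 t nz a b a≼b t≤μa)
      ; ⊙-closed      = λ {a} {b} t≤μa t≤μb → begin
          t             ≲⟨ rmin-greatest t t t (≤ᵢ-refl t) (≤ᵢ-refl t) ⟩
          rmin t t      ≲⟨ ∈∨q⇒∈-below-½ (rmin t t) (μ (a ⊙ b))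
                             (begin rmin t t ≲⟨ rmin-≤ˡ t t ⟩ t ≲⟨ t≤½ ⟩ ½̂ ∎)
                             (dichotomous (a ⊙ b))
                             (λ nz → let nzt = nonzero-rmin-self t nz in
                                     F3 t t nzt nzt a b t≤μa t≤μb) ⟩
          μ (a ⊙ b)     ∎
      ; implicative-⇒ = λ x y t≤μa → begin
          t                          ≲⟨ rmin-greatest t (μ ((x ⇒ y) ↪ x)) ½̂ t≤μa t≤½ ⟩
          rmin (μ ((x ⇒ y) ↪ x)) ½̂  ≲⟨ F13-⇒ x y ⟩
          μ x                        ∎
      ; implicative-↪ = λ x y t≤μa → begin
          t                          ≲⟨ rmin-greatest t (μ ((x ↪ y) ⇒ x)) ½̂ t≤μa t≤½ ⟩
          rmin (μ ((x ↪ y) ⇒ x)) ½̂  ≲⟨ F13-↪ x y ⟩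
          μ x                        ∎
      }

    rmin-½-transfer : ∀ {a b} → (∀ {P} → IsImplicativeFilter P → P a → P b) →
                      rmin (μ a) ½̂ ≤ᵢ μ b
    rmin-½-transfer {a} implication =
      implication (level-isImplicativeFilter t (rmin-≤ʳ (μ a) ½̂)) (rmin-≤ˡ (μ a) ½̂)
      where t = rmin (μ a) ½̂

proposition4p2 : (Rl : RealNumbers) (𝔄 : PseudoBL) →
  let open Intervals Rl
      open PseudoBL 𝔄
      open FuzzyFilters Rl 𝔄
  in (μ : A → D) → Dichotomous μ → IsFuzzyImplicativeFilter μ →
  ∀ x y →
    -- (1)
    ((rmin (μ ((x ⇒ y) ⇒ x)) ½̂ ≤ᵢ μ x)
      × (rmin (μ ((x ↪ y) ↪ x)) ½̂ ≤ᵢ μ x))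
    -- (2)
    × ((rmin (μ (x ⇒ y)) ½̂ ≤ᵢ μ (((y ⇒ x) ↪ x) ⇒ y))
      × (rmin (μ (x ↪ y)) ½̂ ≤ᵢ μ (((y ↪ x) ⇒ x) ↪ y)))
    -- (3)
    × ((rmin (μ ((x ⇒ y) ↪ y)) ½̂ ≤ᵢ μ ((y ↪ x) ⇒ x))
      × (rmin (μ ((x ↪ y) ⇒ y)) ½̂ ≤ᵢ μ ((y ⇒ x) ↪ x)))
    -- (4)
    × ((rmin (μ ((x ⇒ y) ↪ y)) ½̂ ≤ᵢ μ ((y ⇒ x) ↪ x))
      × (rmin (μ ((x ↪ y) ↪ y)) ½̂ ≤ᵢ μ ((y ↪ x) ⇒ x)))
proposition4p2 Rl 𝔄 μ dichotomous isImplicative x y =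
  (transfer (λ F → peirce-⇒ F x y) , transfer (λ F → peirce-↪ F x y)) ,
  (transfer (λ F → ⇒-⇒↪⇒ F x y) , transfer (λ F → ↪-↪⇒↪ F x y)) ,
  (transfer (λ F → ⇒↪-↪⇒ F x y) , transfer (λ F → ↪⇒-⇒↪ F x y)) ,
  (transfer (λ F → ⇒↪-⇒↪ F x y) , transfer (λ F → ↪↪-↪⇒ F x y))
  where
  open PseudoBLProperties.ImplicativeFilterProperties 𝔄
  transfer = LevelSets.rmin-½-transfer Rl 𝔄 dichotomous isImplicative
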